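{- Let $\mathcal{A}\subseteq\mathcal{M}_n(t)$ be a compressed family. Then $|\partial\mathcal{A}|=|\mathcal{A}^1|$, where $\mathcal{A}^1=\{A\in\mathcal{A}\mid A(1)>0\}$.
   Context: $\mathcal{M}_n(t)$ is the family of $t$-element multisets of $[n]$; for a multiset $A$ and $i\in[n]$, $A(i)$ is the multiplicity of $i$ in $A$. The shadow of $\mathcal{A}\subseteq\mathcal{M}_n(t)$ is $\partial\mathcal{A}=\{C\in\mathcal{M}_n(t-1)\mid C\subset A\text{ for some }A\in\mathcal{A}\}$. A family $\mathcal{A}$ is compressed if for all $1\le i<j\le n$ and every $A\in\mathcal{A}$ with $A(j)\ge1$, the multiset $A-\{j\}+\{i\}$ (one copy of $j$ replaced by one copy of $i$) is in $\mathcal{A}$. -}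

module Defs where

open import Data.Nat using (ℕ; suc; _+_; _∸_; _≤_; _<_)
open import Data.Fin using (Fin; zero) renaming (_<_ to _<ᶠ_)
open import Data.Vec using (Vec; lookup; updateAt; sum)
open import Data.List using (List; length; filter)
open import Data.List.Membership.Propositional using (_∈_)
open import Data.List.Relation.Unary.Unique.Propositional using (Unique)
open import Data.List.Relation.Unary.All using (All)
open import Data.Product using (Σ; ∃; _×_)
open import Relation.Binary.PropositionalEquality using (_≡_)
open import Function.Bundles using (_⇔_)
open import Data.Nat.Properties using (_<?_)

-- A multiset on [n] = {1,…,n} is its multiplicity vector; index i : Fin n
-- stands for element (toℕ i + 1), so element 1 is Fin.zero.
Multiset : ℕ → Set
Multiset n = Vec ℕ n

mult : ∀ {n} → Multiset n → Fin n → ℕ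
mult A i = lookup A i

size : ∀ {n} → Multiset n → ℕ
size A = sum A

InM : ∀ {n} → ℕ → Multiset n → Set
InM t A = size A ≡ t

_⊆ₘ_ : ∀ {n} → Multiset n → Multiset n → Set
C ⊆ₘ A = ∀ i → mult C i ≤ mult A i

record Family (n t : ℕ) : Set where
  field
    members : List (Multiset n)
    unique  : Unique members
    inM     : All (InM t) members
open Family public

card : ∀ {n t} → Family n t → ℕ
card 𝒜 = length (members 𝒜)

shift : ∀ {n} → Multiset n → Fin n → Fin n → Multiset n
shift A j i = updateAt (updateAt A j (λ x → x ∸ 1)) i suc

Compressed : ∀ {n t} → Family n t → Set
Compressed {n} 𝒜 =
  ∀ (i j : Fin n) → i <ᶠ j → ∀ A → A ∈ members 𝒜 → 1 ≤ mult A j →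
    shift A j i ∈ members 𝒜

-- C ∈ ∂𝒜 : C ∈ M_n(t-1) (with t - 1 a natural number, i.e. 1 + |C| = t)
-- and C ⊆ A for some A ∈ 𝒜
InShadow : ∀ {n t} → Family n t → Multiset n → Set
InShadow {t = t} 𝒜 C = (suc (size C) ≡ t) × ∃ λ A → A ∈ members 𝒜 × C ⊆ₘ A

IsShadow : ∀ {n t} → Family n t → List (Multiset n) → Set
IsShadow {n} 𝒜 S = Unique S × (∀ (C : Multiset n) → (C ∈ S ⇔ InShadow 𝒜 C))

card¹ : ∀ {n t} → Family (suc n) t → ℕ
card¹ 𝒜 = length (filter (λ A → 0 <? mult A zero) (members 𝒜))

{-# OPTIONS --safe #-}
-- Adding one copy of 1 is a bijection C ↦ C + {1} from ∂𝒜 onto 𝒜¹.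
-- It is injective, and its inverse is A ↦ A − {1}. It lands in 𝒜: a shadow
-- element C ⊂ A ∈ 𝒜 is A − {j} for some j, so C + {1} is either A (if j = 1)
-- or the compression A − {j} + {1} of A, which lies in 𝒜.
module Submission where

open import Defs
open import Data.Nat using (ℕ; zero; suc; _+_; _∸_; _≤_; _<_; z≤n; s≤s)
open import Data.Nat.Properties
  using (_<?_; +-mono-≤; +-mono-<-≤; +-suc; +-cancelˡ-≡; suc-injective; <-irrefl; m≤n⇒m<n∨m≡n; m∸n≤m; m+[n∸m]≡n; ≤-refl)
open import Data.Fin using (Fin; zero; suc)
open import Data.Vec using ([]; _∷_; updateAt)
open import Data.Vec.Properties using (updateAt-updateAt; updateAt-id-local; lookup∘updateAt)
open import Data.List using (List; length; map; filter)
open import Data.List.Properties using (length-map)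
open import Data.List.Membership.Propositional using (_∈_)
open import Data.List.Membership.Propositional.Properties using (∈-map⁺; ∈-map⁻; ∈-filter⁺; ∈-filter⁻)
open import Data.List.Membership.Propositional.Properties.WithK using (unique∧set⇒bag)
open import Data.List.Relation.Binary.BagAndSetEquality using (∼bag⇒↭)
open import Data.List.Relation.Binary.Permutation.Propositional.Properties using (↭-length)
open import Data.List.Relation.Unary.Unique.Propositional using (Unique)
import Data.List.Relation.Unary.Unique.Propositional.Properties as Unique
import Data.List.Relation.Unary.All as All
open import Data.Product using (∃; ∃-syntax; _×_; _,_)
open import Data.Sum using (inj₁; inj₂)
open import Data.Empty using (⊥-elim)
open import Function.Bundles using (mk⇔; Equivalence)
open import Relation.Unary using (Decidable)
open import Relation.Binary.PropositionalEquality using (_≡_; refl; sym; trans; cong; subst)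

length-≡-by-bijection : ∀ {a b} {A : Set a} {B : Set b} {f : A → B} {xs : List A} {ys : List B} →
  (∀ {x y} → f x ≡ f y → x ≡ y) → Unique xs → Unique ys →
  (∀ {x} → x ∈ xs → f x ∈ ys) → (∀ {y} → y ∈ ys → ∃ λ x → x ∈ xs × f x ≡ y) →
  length xs ≡ length ys
length-≡-by-bijection {f = f} {xs} {ys} f-injective xs-unique ys-unique maps-into maps-onto =
  trans (sym (length-map f xs))
    (↭-length (∼bag⇒↭ (unique∧set⇒bag (Unique.map⁺ f-injective xs-unique) ys-unique (mk⇔ to from))))
  where
  to : ∀ {y} → y ∈ map f xs → y ∈ ys
  to y∈fxs with _ , x∈xs , refl ← ∈-map⁻ f y∈fxs = maps-into x∈xs
  from : ∀ {y} → y ∈ ys → y ∈ map f xs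
  from y∈ys with _ , x∈xs , refl ← maps-onto y∈ys = ∈-map⁺ f x∈xs

-- Chosen so that shift A j i is definitionally insert (remove A j) i.
remove : ∀ {n} → Multiset n → Fin n → Multiset n
remove A j = updateAt A j (_∸ 1)

insert : ∀ {n} → Multiset n → Fin n → Multiset n
insert C i = updateAt C i suc

size-insert : ∀ {n} (C : Multiset n) (i : Fin n) → size (insert C i) ≡ suc (size C)
size-insert (c ∷ C) zero    = refl
size-insert (c ∷ C) (suc i) = trans (cong (c +_) (size-insert C i)) (+-suc c (size C))

0<mult-insert : ∀ {n} (C : Multiset n) (i : Fin n) → 0 < mult (insert C i) i
0<mult-insert C i = subst (0 <_) (sym (lookup∘updateAt i C)) (s≤s z≤n)

remove-insert : ∀ {n} (C : Multiset n) (i : Fin n) → remove (insert C i) i ≡ C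
remove-insert C i = trans (updateAt-updateAt i C) (updateAt-id-local i C refl)

insert-injective : ∀ {n} {C D : Multiset n} {i} → insert C i ≡ insert D i → C ≡ D
insert-injective {C = C} {D} {i} eq =
  trans (sym (remove-insert C i)) (trans (cong (λ A → remove A i) eq) (remove-insert D i))

insert-remove : ∀ {n} {A : Multiset n} {j} → 0 < mult A j → insert (remove A j) j ≡ A
insert-remove {A = A} {j} 0<Aj =
  trans (updateAt-updateAt j A) (updateAt-id-local j A (m+[n∸m]≡n {1} {mult A j} 0<Aj))

size-remove : ∀ {n} {A : Multiset n} {j} → 0 < mult A j → suc (size (remove A j)) ≡ size A
size-remove {A = A} {j} 0<Aj =
  trans (sym (size-insert (remove A j) j)) (cong size (insert-remove {A = A} 0<Aj))

remove-⊆ₘ : ∀ {n} (A : Multiset n) (j : Fin n) → remove A j ⊆ₘ A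
remove-⊆ₘ (a ∷ A) zero    zero    = m∸n≤m a 1
remove-⊆ₘ (a ∷ A) zero    (suc i) = ≤-refl
remove-⊆ₘ (a ∷ A) (suc j) zero    = ≤-refl
remove-⊆ₘ (a ∷ A) (suc j) (suc i) = remove-⊆ₘ A j i

⊆ₘ-tail : ∀ {n} {c a} {C A : Multiset n} → (c ∷ C) ⊆ₘ (a ∷ A) → C ⊆ₘ A
⊆ₘ-tail C⊆A i = C⊆A (suc i)

size-mono-⊆ₘ : ∀ {n} {C A : Multiset n} → C ⊆ₘ A → size C ≤ size A
size-mono-⊆ₘ {C = []}    {[]}    _   = z≤n
size-mono-⊆ₘ {C = _ ∷ C} {_ ∷ A} C⊆A = +-mono-≤ (C⊆A zero) (size-mono-⊆ₘ {C = C} {A} (⊆ₘ-tail C⊆A))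

⊆ₘ∧size≡⇒≡ : ∀ {n} {C A : Multiset n} → C ⊆ₘ A → size C ≡ size A → C ≡ A
⊆ₘ∧size≡⇒≡ {C = []}    {[]}    _   _ = refl
⊆ₘ∧size≡⇒≡ {C = c ∷ C} {a ∷ A} C⊆A eq with m≤n⇒m<n∨m≡n (C⊆A zero)
... | inj₁ c<a  = ⊥-elim (<-irrefl eq (+-mono-<-≤ c<a (size-mono-⊆ₘ {C = C} {A} (⊆ₘ-tail C⊆A))))
... | inj₂ refl = cong (c ∷_) (⊆ₘ∧size≡⇒≡ (⊆ₘ-tail C⊆A) (+-cancelˡ-≡ c _ _ eq))

⊆ₘ∧suc-size≡⇒remove : ∀ {n} {C A : Multiset n} → C ⊆ₘ A → suc (size C) ≡ size A →
  ∃[ j ] 0 < mult A j × remove A j ≡ C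
⊆ₘ∧suc-size≡⇒remove {C = c ∷ C} {a ∷ A} C⊆A eq with m≤n⇒m<n∨m≡n (C⊆A zero)
... | inj₂ refl
  with j , 0<Aj , refl ← ⊆ₘ∧suc-size≡⇒remove {C = C} {A} (⊆ₘ-tail C⊆A)
                             (+-cancelˡ-≡ c _ _ (trans (+-suc c (size C)) eq))
  = suc j , 0<Aj , refl
⊆ₘ∧suc-size≡⇒remove {C = c ∷ C} {suc a ∷ A} C⊆A eq | inj₁ (s≤s c≤a) =
  zero , s≤s z≤n , sym (⊆ₘ∧size≡⇒≡ C⊆remove (suc-injective eq))
  where
  C⊆remove : (c ∷ C) ⊆ₘ (a ∷ A)
  C⊆remove zero    = c≤a
  C⊆remove (suc i) = C⊆A (suc i)

module _ {n t : ℕ} (𝒜 : Family (suc n) t) where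

  insert₁-shadow∈ : Compressed 𝒜 → ∀ {C} → InShadow 𝒜 C → insert C zero ∈ members 𝒜
  insert₁-shadow∈ compressed {C} (suc|C|≡t , A , A∈𝒜 , C⊆A)
    with ⊆ₘ∧suc-size≡⇒remove {C = C} {A} C⊆A (trans suc|C|≡t (sym (All.lookup (inM 𝒜) A∈𝒜)))
  ... | zero  , 0<A₁ , refl = subst (_∈ members 𝒜) (sym (insert-remove 0<A₁)) A∈𝒜
  ... | suc j , 0<Aj , refl = compressed zero (suc j) (s≤s z≤n) A A∈𝒜 0<Aj

  remove₁-shadow : ∀ {A} → A ∈ members 𝒜 → 0 < mult A zero → InShadow 𝒜 (remove A zero)
  remove₁-shadow {A} A∈𝒜 0<A₁ =
    trans (size-remove {A = A} 0<A₁) (All.lookup (inM 𝒜) A∈𝒜) , A , A∈𝒜 , remove-⊆ₘ A zero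

lemma1 : (n t : ℕ) (𝒜 : Family (suc n) t) → Compressed 𝒜 →
    (S : List (Multiset (suc n))) → IsShadow 𝒜 S → length S ≡ card¹ 𝒜
lemma1 n t 𝒜 compressed S (S-unique , S⇔∂𝒜) =
  length-≡-by-bijection insert-injective S-unique (Unique.filter⁺ 0<mult₁? (unique 𝒜)) into onto
  where
  0<mult₁? : Decidable λ (A : Multiset (suc n)) → 0 < mult A zero
  0<mult₁? A = 0 <? mult A zero
  into : ∀ {C} → C ∈ S → insert C zero ∈ filter 0<mult₁? (members 𝒜)
  into {C} C∈S =
    ∈-filter⁺ 0<mult₁? (insert₁-shadow∈ 𝒜 compressed (Equivalence.to (S⇔∂𝒜 C) C∈S)) (0<mult-insert C zero)
  onto : ∀ {A} → A ∈ filter 0<mult₁? (members 𝒜) → ∃ λ C → C ∈ S × insert C zero ≡ A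
  onto {A} A∈𝒜¹ with A∈𝒜 , 0<A₁ ← ∈-filter⁻ 0<mult₁? A∈𝒜¹ =
    remove A zero , Equivalence.from (S⇔∂𝒜 _) (remove₁-shadow 𝒜 A∈𝒜 0<A₁) , insert-remove 0<A₁
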